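{- For every integer $n\ge1$, $|S_n|=3(w_n-2)^2+2(w_n-2)-6(w_n-w_{n-1})(w_n-w_{n-1}-1)$.
   Context: For $k\ge0$, $w_{2k}=3\cdot2^k$, $w_{2k+1}=4\cdot2^k$. $S_n=\{x+yi\in\mathbb{Z}[i]\setminus\{0\}: |x|,|y|\le w_n-2,\ |x|+|y|\le w_{n+1}-3,\ 2\nmid\gcd(x,y)\}$. -}

module Defs where

open import Data.Nat as ℕ using (ℕ; suc)
import Data.Nat.DivMod as ℕ
open import Data.Integer using (ℤ; +_; _+_; _-_; _*_; ∣_∣; _≤_; 0ℤ)
open import Data.Integer.GCD using (gcd)
open import Data.Integer.Divisibility using (_∣_)
open import Data.Product using (_×_; _,_)
open import Relation.Nullary using (¬_)
open import Relation.Binary.PropositionalEquality using (_≡_; _≢_)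
open import Data.List using (List; length)
open import Data.List.Membership.Propositional using (_∈_)
open import Data.List.Relation.Unary.Unique.Propositional using (Unique)

-- w_{2k} = 3·2^k, w_{2k+1} = 4·2^k, i.e. w_n = (3 + n mod 2)·2^(n div 2)
w : ℕ → ℕ
w n = (3 ℕ.+ n ℕ.% 2) ℕ.* (2 ℕ.^ (n ℕ./ 2))

wℤ : ℕ → ℤ
wℤ n = + w n

-- Gaussian integers x + y i represented by pairs (x , y)
ℤ[i] : Set
ℤ[i] = ℤ × ℤ

InS : ℕ → ℤ[i] → Set
InS n (x , y) =
  ((x , y) ≢ (0ℤ , 0ℤ)) ×
  (+ ∣ x ∣ ≤ wℤ n - + 2) ×
  (+ ∣ y ∣ ≤ wℤ n - + 2) ×
  (+ ∣ x ∣ + + ∣ y ∣ ≤ wℤ (suc n) - + 3) ×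
  (¬ (+ 2 ∣ gcd x y))

-- "the set P has exactly N elements": some duplicate-free list enumerates P
-- (count given as an integer, so the claimed value itself must be a natural number)
HasCard : {A : Set} → (A → Set) → ℤ → Set
HasCard {A} P N =
  Data.Product.Σ (List A) λ l →
    Unique l × ((a : A) → (a ∈ l → P a) × (P a → a ∈ l)) × (+ length l ≡ N)

module Submission where

-- Put a = w_n − 2 and b = w_{n+1} − 3. Then S_n consists of the points (x, y) of the box
-- |x|, |y| ≤ a with |x| + |y| ≤ b whose coordinates are not both even (this already excludes 0).
-- For either parity of n one has a = 2(q + 1 + j), b = a + 2q + 1 and w_n − w_{n−1} = j + 1.
-- Count column by column, pairing |x| ∈ {2i + 1, 2i + 2}: with c = min(a, b − 2i − 1), which is
-- even, the odd column has 2c + 1 admissible points and the even column c. With both signs of x a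
-- pair thus contributes 6c + 2 points: as many as in the full box for the first q + 1 pairs, and
-- 12(l + 1) fewer for the l-th pair after them. So |S_n| = (3a² + 2a) − 6j(j + 1).

open import Defs

module OctagonCount where

  open import Data.Empty using (⊥-elim)
  open import Data.Integer as ℤ using (ℤ; +_; -[1+_]; ∣_∣)
  import Data.Integer.Properties as ℤP
  import Data.Integer.Tactic.RingSolver as ℤSolver
  open import Data.List using (List; []; _∷_; _++_; map; length; filter; cartesianProduct)
  open import Data.List.Membership.Propositional using (_∈_)
  open import Data.List.Membership.Propositional.Properties
    using (∈-filter⁺; ∈-filter⁻; ∈-cartesianProduct⁺; ∈-cartesianProduct⁻)
  open import Data.List.Properties using (filter-accept; filter-reject; filter-++; length-++)
  open import Data.List.Relation.Unary.All as All using (All; []; _∷_)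
  open import Data.List.Relation.Unary.AllPairs using ([]; _∷_)
  open import Data.List.Relation.Unary.Any using (here; there)
  open import Data.List.Relation.Unary.Unique.Propositional using (Unique)
  open import Data.List.Relation.Unary.Unique.Propositional.Properties using (filter⁺; cartesianProduct⁺)
  open import Data.Nat
  open import Data.Nat.DivMod using (_%_; m*n%n≡0; m*n/n≡m; [m+kn]%n≡m%n; +-distrib-/)
  open import Data.Nat.Divisibility using (_∣_; _∣?_; divides; ∣-trans; ∣m+n∣m⇒∣n; ∣1⇒≡1)
  open import Data.Nat.GCD using (gcd-greatest; gcd[m,n]∣m; gcd[m,n]∣n)
  open import Data.Nat.ListAction using (sum)
  open import Data.Nat.Properties
  open import Data.Nat.Tactic.RingSolver using (solve-∀)
  open import Data.Product using (_×_; _,_; proj₁; proj₂; ∃)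
  open import Data.Sum using (_⊎_; inj₁; inj₂)
  open import Data.Unit using (⊤; tt)
  open import Function using (_∘_; _⇔_; mk⇔)
  open import Function.Bundles using (module Equivalence)
  open import Relation.Binary.PropositionalEquality
  open import Relation.Nullary using (¬_; yes; no; ¬?; _×-dec_)
  open import Relation.Unary using (Decidable)

  private
    variable
      A : Set

  filter-≐-All : ∀ {P Q : A → Set} (P? : Decidable P) (Q? : Decidable Q) {xs} →
    All (λ x → P x ⇔ Q x) xs → filter P? xs ≡ filter Q? xs
  filter-≐-All P? Q? [] = refl
  filter-≐-All P? Q? {x ∷ _} (e ∷ es) with P? x
  ... | yes p = trans (cong (x ∷_) (filter-≐-All P? Q? es)) (sym (filter-accept Q? (Equivalence.to e p)))
  ... | no ¬p = trans (filter-≐-All P? Q? es) (sym (filter-reject Q? (¬p ∘ Equivalence.from e)))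

  length-filter-cartesianProduct : ∀ {B : Set} {P : A × B → Set} (P? : Decidable P) xs ys →
    length (filter P? (cartesianProduct xs ys)) ≡ sum (map (λ x → length (filter (λ y → P? (x , y)) ys)) xs)
  length-filter-cartesianProduct P? [] ys = refl
  length-filter-cartesianProduct P? (x ∷ xs) ys = begin
    length (filter P? (map (x ,_) ys ++ cartesianProduct xs ys))
      ≡⟨ cong length (filter-++ P? (map (x ,_) ys) _) ⟩
    length (filter P? (map (x ,_) ys) ++ filter P? (cartesianProduct xs ys))
      ≡⟨ length-++ (filter P? (map (x ,_) ys)) ⟩
    length (filter P? (map (x ,_) ys)) + length (filter P? (cartesianProduct xs ys))
      ≡⟨ cong₂ _+_ (length-filter-map ys) (length-filter-cartesianProduct P? xs ys) ⟩
    length (filter (λ y → P? (x , y)) ys) + sum (map (λ x → length (filter (λ y → P? (x , y)) ys)) xs)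
      ∎
    where
    open ≡-Reasoning
    length-filter-map : ∀ ys → length (filter P? (map (x ,_) ys)) ≡ length (filter (λ y → P? (x , y)) ys)
    length-filter-map [] = refl
    length-filter-map (y ∷ ys) with P? (x , y)
    ... | yes _ = cong suc (length-filter-map ys)
    ... | no _ = length-filter-map ys

  range : ℕ → List ℤ
  range zero = + 0 ∷ []
  range (suc a) = -[1+ a ] ∷ + suc a ∷ range a

  ∈-range⁻ : ∀ {a z} → z ∈ range a → ∣ z ∣ ≤ a
  ∈-range⁻ {zero} (here refl) = z≤n
  ∈-range⁻ {suc a} (here refl) = ≤-refl
  ∈-range⁻ {suc a} (there (here refl)) = ≤-refl
  ∈-range⁻ {suc a} (there (there z∈)) = m≤n⇒m≤1+n (∈-range⁻ z∈)

  ∈-range⁺ : ∀ {a} z → ∣ z ∣ ≤ a → z ∈ range a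
  ∈-range⁺ {zero} (+ zero) _ = here refl
  ∈-range⁺ {suc a} (+ zero) _ = there (there (∈-range⁺ (+ 0) z≤n))
  ∈-range⁺ {suc a} (+ suc m) (s≤s m≤a) with m ≟ a
  ... | yes refl = there (here refl)
  ... | no m≢a = there (there (∈-range⁺ (+ suc m) (≤∧≢⇒< m≤a m≢a)))
  ∈-range⁺ {suc a} -[1+ m ] (s≤s m≤a) with m ≟ a
  ... | yes refl = here refl
  ... | no m≢a = there (there (∈-range⁺ -[1+ m ] (≤∧≢⇒< m≤a m≢a)))

  range-unique : ∀ a → Unique (range a)
  range-unique zero = [] ∷ []
  range-unique (suc a) = ((λ ()) ∷ outside -[1+ a ] refl) ∷ outside (+ suc a) refl ∷ range-unique a
    where
    outside : ∀ z → ∣ z ∣ ≡ suc a → All (z ≢_) (range a)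
    outside z ∣z∣≡1+a = All.tabulate λ z′∈ z≡z′ →
      <⇒≱ (≤-reflexive (sym ∣z∣≡1+a)) (subst (λ t → ∣ t ∣ ≤ a) (sym z≡z′) (∈-range⁻ z′∈))

  symCount : {P : ℕ → Set} → Decidable P → ℕ → ℕ
  symCount P? a = length (filter (P? ∘ ∣_∣) (range a))

  symSum : (ℕ → ℕ) → ℕ → ℕ
  symSum f a = sum (map (f ∘ ∣_∣) (range a))

  symCount-cong : ∀ {P Q : ℕ → Set} (P? : Decidable P) (Q? : Decidable Q) a →
    (∀ {v} → v ≤ a → P v ⇔ Q v) → symCount P? a ≡ symCount Q? a
  symCount-cong P? Q? a P⇔Q =
    cong length (filter-≐-All (P? ∘ ∣_∣) (Q? ∘ ∣_∣) (All.tabulate (P⇔Q ∘ ∈-range⁻)))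

  symCount-accept : ∀ {P : ℕ → Set} (P? : Decidable P) {a} →
    P (suc a) → symCount P? (suc a) ≡ 2 + symCount P? a
  symCount-accept P? p =
    cong length (trans (filter-accept (P? ∘ ∣_∣) p) (cong (_ ∷_) (filter-accept (P? ∘ ∣_∣) p)))

  symCount-reject : ∀ {P : ℕ → Set} (P? : Decidable P) {a} →
    ¬ P (suc a) → symCount P? (suc a) ≡ symCount P? a
  symCount-reject P? ¬p =
    cong length (trans (filter-reject (P? ∘ ∣_∣) ¬p) (filter-reject (P? ∘ ∣_∣) ¬p))

  below : ∀ {P : ℕ → Set} c → Decidable P → Decidable (λ v → v ≤ c × P v)
  below c P? v = v ≤? c ×-dec P? v

  symCount-⊓ : ∀ {P : ℕ → Set} (P? : Decidable P) {c} a → symCount (below c P?) a ≡ symCount P? (a ⊓ c)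
  symCount-⊓ P? {c} a with a ≤? c
  ... | yes a≤c = begin
    symCount (below c P?) a ≡⟨ symCount-cong (below c P?) P? a (λ v≤a → mk⇔ proj₂ (≤-trans v≤a a≤c ,_)) ⟩
    symCount P? a           ≡⟨ cong (symCount P?) (m≤n⇒m⊓n≡m a≤c) ⟨
    symCount P? (a ⊓ c)     ∎
    where open ≡-Reasoning
  symCount-⊓ P? zero | no 0≰c = ⊥-elim (0≰c z≤n)
  symCount-⊓ P? {c} (suc a) | no 1+a≰c = begin
    symCount (below c P?) (suc a) ≡⟨ symCount-reject (below c P?) (λ (1+a≤c , _) → 1+a≰c 1+a≤c) ⟩
    symCount (below c P?) a       ≡⟨ symCount-⊓ P? a ⟩
    symCount P? (a ⊓ c)           ≡⟨ cong (symCount P?) (trans (m≥n⇒m⊓n≡n c≤a) (sym (m≥n⇒m⊓n≡n c≤1+a))) ⟩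
    symCount P? (suc a ⊓ c)       ∎
    where
    open ≡-Reasoning
    c≤a = s≤s⁻¹ (≰⇒> 1+a≰c)
    c≤1+a = m≤n⇒m≤1+n c≤a

  all? : Decidable (λ (_ : ℕ) → ⊤)
  all? _ = yes tt

  symCount-all : ∀ a → symCount all? a ≡ suc (a * 2)
  symCount-all zero = refl
  symCount-all (suc a) = cong (suc ∘ suc) (symCount-all a)

  ¬2∣1+k*2 : ∀ k → ¬ 2 ∣ suc (k * 2)
  ¬2∣1+k*2 k 2∣1+k*2 with ∣1⇒≡1 (∣m+n∣m⇒∣n (subst (2 ∣_) (+-comm 1 (k * 2)) 2∣1+k*2) (divides k refl))
  ... | ()

  odd? : Decidable (λ v → ¬ 2 ∣ v)
  odd? v = ¬? (2 ∣? v)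

  symCount-odd : ∀ {m} → 2 ∣ m → symCount odd? m ≡ m
  symCount-odd (divides k refl) = go k
    where
    go : ∀ k → symCount odd? (k * 2) ≡ k * 2
    go zero = refl
    go (suc k) = begin
      symCount odd? (suc (suc (k * 2))) ≡⟨ symCount-reject odd? (λ 2∤ → 2∤ (divides (suc k) refl)) ⟩
      symCount odd? (suc (k * 2))       ≡⟨ symCount-accept odd? (¬2∣1+k*2 k) ⟩
      suc (suc (symCount odd? (k * 2))) ≡⟨ cong (suc ∘ suc) (go k) ⟩
      suc (suc (k * 2))                 ∎
      where open ≡-Reasoning

  symSum-step : ∀ f k → symSum f (suc k * 2) ≡ symSum f (k * 2) + 2 * (f (suc (k * 2)) + f (suc k * 2))
  symSum-step f k = lemma (f (suc k * 2)) (f (suc (k * 2))) (symSum f (k * 2))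
    where
    lemma : ∀ x y s → x + (x + (y + (y + s))) ≡ s + 2 * (y + x)
    lemma = solve-∀

  Admissible : ℕ → ℕ → ℕ → Set
  Admissible b u v = u + v ≤ b × ¬ ((2 ∣ u) × (2 ∣ v))

  admissible? : ∀ b u → Decidable (Admissible b u)
  admissible? b u v = u + v ≤? b ×-dec ¬? (2 ∣? u ×-dec 2 ∣? v)

  row : ℕ → ℕ → ℕ → ℕ
  row a b u = symCount (admissible? b u) a

  row-odd : ∀ {a b u c} → ¬ 2 ∣ u → u + c ≡ b → row a b u ≡ suc ((a ⊓ c) * 2)
  row-odd {a} {b} {u} {c} 2∤u u+c≡b = begin
    row a b u                 ≡⟨ symCount-cong (admissible? b u) (below c all?) a (λ _ → mk⇔ to from) ⟩
    symCount (below c all?) a ≡⟨ symCount-⊓ all? a ⟩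
    symCount all? (a ⊓ c)     ≡⟨ symCount-all (a ⊓ c) ⟩
    suc ((a ⊓ c) * 2)         ∎
    where
    open ≡-Reasoning
    to : ∀ {v} → Admissible b u v → v ≤ c × ⊤
    to {v} (u+v≤b , _) = +-cancelˡ-≤ u v c (subst (u + v ≤_) (sym u+c≡b) u+v≤b) , tt
    from : ∀ {v} → v ≤ c × ⊤ → Admissible b u v
    from (v≤c , _) = subst (_ ≤_) u+c≡b (+-monoʳ-≤ u v≤c) , 2∤u ∘ proj₁

  row-even : ∀ {a b u c} → 2 ∣ a → 2 ∣ u → 2 ∣ c → u + c ≡ suc b → row a b u ≡ a ⊓ c
  row-even {a} {b} {u} {c} 2∣a 2∣u 2∣c u+c≡1+b = begin
    row a b u                 ≡⟨ symCount-cong (admissible? b u) (below c odd?) a (λ _ → mk⇔ to from) ⟩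
    symCount (below c odd?) a ≡⟨ symCount-⊓ odd? a ⟩
    symCount odd? (a ⊓ c)     ≡⟨ symCount-odd 2∣a⊓c ⟩
    a ⊓ c                     ∎
    where
    open ≡-Reasoning
    2∣a⊓c : 2 ∣ a ⊓ c
    2∣a⊓c with ⊓-sel a c
    ... | inj₁ a⊓c≡a = subst (2 ∣_) (sym a⊓c≡a) 2∣a
    ... | inj₂ a⊓c≡c = subst (2 ∣_) (sym a⊓c≡c) 2∣c
    to : ∀ {v} → Admissible b u v → v ≤ c × ¬ 2 ∣ v
    to {v} (u+v≤b , ¬2∣u×v) =
      <⇒≤ (+-cancelˡ-< u v c (subst (u + v <_) (sym u+c≡1+b) (s≤s u+v≤b))) , λ 2∣v → ¬2∣u×v (2∣u , 2∣v)
    -- As c is even, an odd v ≤ c is in fact < c.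
    from : ∀ {v} → v ≤ c × ¬ 2 ∣ v → Admissible b u v
    from {v} (v≤c , 2∤v) = s≤s⁻¹ (subst (u + v <_) u+c≡1+b (+-monoʳ-< u v<c)) , 2∤v ∘ proj₂
      where v<c = ≤∧≢⇒< v≤c (λ v≡c → 2∤v (subst (2 ∣_) (sym v≡c) 2∣c))

  row-pair : ∀ {a b c} i → 2 ∣ a → 2 ∣ c → suc (i * 2) + c ≡ b →
    row a b (suc (i * 2)) + row a b (suc i * 2) ≡ 3 * (a ⊓ c) + 1
  row-pair {a} {b} {c} i 2∣a 2∣c u+c≡b = begin
    row a b (suc (i * 2)) + row a b (suc i * 2)
      ≡⟨ cong₂ _+_ (row-odd {a = a} (¬2∣1+k*2 i) u+c≡b)
                   (row-even 2∣a (divides (suc i) refl) 2∣c (cong suc u+c≡b)) ⟩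
    suc ((a ⊓ c) * 2) + a ⊓ c
      ≡⟨ lemma (a ⊓ c) ⟩
    3 * (a ⊓ c) + 1
      ∎
    where
    open ≡-Reasoning
    lemma : ∀ m → suc (m * 2) + m ≡ 3 * m + 1
    lemma = solve-∀

  lattice : ℕ → ℕ → List (ℤ × ℤ)
  lattice a b = filter (λ (x , y) → admissible? b ∣ x ∣ ∣ y ∣) (cartesianProduct (range a) (range a))

  lattice-unique : ∀ a b → Unique (lattice a b)
  lattice-unique a b =
    filter⁺ (λ (x , y) → admissible? b ∣ x ∣ ∣ y ∣) (cartesianProduct⁺ (range-unique a) (range-unique a))

  ∈-lattice : ∀ {a b x y} →
    (x , y) ∈ lattice a b ⇔ (∣ x ∣ ≤ a × ∣ y ∣ ≤ a × Admissible b ∣ x ∣ ∣ y ∣)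
  ∈-lattice {a} {b} {x} {y} = mk⇔ to from
    where
    P? = λ ((x , y) : ℤ × ℤ) → admissible? b ∣ x ∣ ∣ y ∣
    to : (x , y) ∈ lattice a b → ∣ x ∣ ≤ a × ∣ y ∣ ≤ a × Admissible b ∣ x ∣ ∣ y ∣
    to xy∈ =
      let xy∈box , adm = ∈-filter⁻ P? {xs = cartesianProduct (range a) (range a)} xy∈
          x∈ , y∈ = ∈-cartesianProduct⁻ (range a) (range a) xy∈box
      in ∈-range⁻ x∈ , ∈-range⁻ y∈ , adm
    from : ∣ x ∣ ≤ a × ∣ y ∣ ≤ a × Admissible b ∣ x ∣ ∣ y ∣ → (x , y) ∈ lattice a b
    from (∣x∣≤a , ∣y∣≤a , adm) =
      ∈-filter⁺ P? (∈-cartesianProduct⁺ (∈-range⁺ x ∣x∣≤a) (∈-range⁺ y ∣y∣≤a)) adm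

  +[m+n]-+n≡+m : ∀ m n → + (m + n) ℤ.- + n ≡ + m
  +[m+n]-+n≡+m m n = trans (ℤP.m-n≡m⊖n (m + n) n) (trans (ℤP.⊖-≥ (m≤n+m n m)) (cong +_ (m+n∸n≡m m n)))

  InS⇔ : ∀ {n a b} → wℤ n ℤ.- + 2 ≡ + a → wℤ (suc n) ℤ.- + 3 ≡ + b → ∀ {x y} →
    InS n (x , y) ⇔ (∣ x ∣ ≤ a × ∣ y ∣ ≤ a × Admissible b ∣ x ∣ ∣ y ∣)
  InS⇔ {n} {a} {b} A≡a B≡b {x} {y} = mk⇔ to from
    where
    bound⁻ : ∀ {m k} {W : ℤ} → W ≡ + k → + m ℤ.≤ W → m ≤ k
    bound⁻ W≡k m≤W = ℤP.drop‿+≤+ (subst (_ ℤ.≤_) W≡k m≤W)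
    bound⁺ : ∀ {m k} {W : ℤ} → W ≡ + k → m ≤ k → + m ℤ.≤ W
    bound⁺ W≡k m≤k = subst (_ ℤ.≤_) (sym W≡k) (ℤ.+≤+ m≤k)
    to : InS n (x , y) → ∣ x ∣ ≤ a × ∣ y ∣ ≤ a × Admissible b ∣ x ∣ ∣ y ∣
    to (_ , x≤ , y≤ , x+y≤ , 2∤gcd) =
      bound⁻ A≡a x≤ , bound⁻ A≡a y≤ , bound⁻ B≡b x+y≤ ,
      λ (2∣x , 2∣y) → 2∤gcd (gcd-greatest 2∣x 2∣y)
    from : ∣ x ∣ ≤ a × ∣ y ∣ ≤ a × Admissible b ∣ x ∣ ∣ y ∣ → InS n (x , y)
    from (x≤ , y≤ , x+y≤ , ¬2∣x×y) =
      (λ { refl → ¬2∣x×y (divides 0 refl , divides 0 refl) }) ,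
      bound⁺ A≡a x≤ , bound⁺ A≡a y≤ , bound⁺ B≡b x+y≤ ,
      λ 2∣gcd → ¬2∣x×y (∣-trans 2∣gcd (gcd[m,n]∣m ∣ x ∣ ∣ y ∣) ,
                         ∣-trans 2∣gcd (gcd[m,n]∣n ∣ x ∣ ∣ y ∣))

  sizeFormula : ℤ → ℤ → ℤ
  sizeFormula A D = + 3 ℤ.* A ℤ.* A ℤ.+ + 2 ℤ.* A ℤ.- + 6 ℤ.* D ℤ.* (D ℤ.- + 1)

  sizeS : ℕ → ℤ
  sizeS n = sizeFormula (wℤ n ℤ.- + 2) (wℤ n ℤ.- wℤ (n ∸ 1))

  sizeFormula-+ : ∀ {N a d} → N + 6 * (d * suc d) ≡ 3 * (a * a) + 2 * a → + N ≡ sizeFormula (+ a) (+ suc d)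
  sizeFormula-+ {N} {a} {d} N+6d[d+1]≡3a²+2a = begin
    + N
      ≡⟨ +[m+n]-+n≡+m N (6 * (d * suc d)) ⟨
    + (N + 6 * (d * suc d)) ℤ.- + (6 * (d * suc d))
      ≡⟨ cong (λ m → + m ℤ.- + (6 * (d * suc d))) N+6d[d+1]≡3a²+2a ⟩
    + (3 * (a * a) + 2 * a) ℤ.- + (6 * (d * suc d))
      ≡⟨ cong₂ ℤ._-_ (trans (ℤP.pos-+ (3 * (a * a)) (2 * a)) (cong₂ ℤ._+_ (pos-*-*ʳ 3 a a) (ℤP.pos-* 2 a)))
                     (pos-*-*ʳ 6 d (suc d)) ⟩
    + 3 ℤ.* (+ a ℤ.* + a) ℤ.+ + 2 ℤ.* + a ℤ.- + 6 ℤ.* (+ d ℤ.* (+ 1 ℤ.+ + d))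
      ≡⟨ ring (+ a) (+ d) ⟩
    sizeFormula (+ a) (+ suc d)
      ∎
    where
    open ≡-Reasoning
    pos-*-*ʳ : ∀ k m n → + (k * (m * n)) ≡ + k ℤ.* (+ m ℤ.* + n)
    pos-*-*ʳ k m n = trans (ℤP.pos-* k (m * n)) (cong (+ k ℤ.*_) (ℤP.pos-* m n))
    ring : ∀ A D → + 3 ℤ.* (A ℤ.* A) ℤ.+ + 2 ℤ.* A ℤ.- + 6 ℤ.* (D ℤ.* (+ 1 ℤ.+ D))
                 ≡ + 3 ℤ.* A ℤ.* A ℤ.+ + 2 ℤ.* A ℤ.- + 6 ℤ.* (+ 1 ℤ.+ D) ℤ.* ((+ 1 ℤ.+ D) ℤ.- + 1)
    ring = ℤSolver.solve-∀

  module Octagon (q j : ℕ) where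

    h a b : ℕ
    h = suc (q + j)
    a = h * 2
    b = a + suc (q * 2)

    2∣a : 2 ∣ a
    2∣a = divides h refl

    -- The count of admissible points with |x| ≤ 2i, |y| ≤ a if |x| + |y| ≤ b were not imposed.
    boxCount : ℕ → ℕ
    boxCount i = a + i * 2 * (3 * a + 1)

    boxCount-suc : ∀ i → boxCount i + 2 * (3 * a + 1) ≡ boxCount (suc i)
    boxCount-suc i = lemma a i
      where
      lemma : ∀ a i → a + i * 2 * (3 * a + 1) + 2 * (3 * a + 1) ≡ a + suc i * 2 * (3 * a + 1)
      lemma = solve-∀

    row-zero : row a b 0 ≡ a
    row-zero = trans (row-even 2∣a (divides 0 refl) (divides (h + suc q) (lemma h q)) refl)
                     (m≤n⇒m⊓n≡m (m≤n⇒m≤1+n (m≤m+n a _)))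
      where
      lemma : ∀ h q → suc (h * 2 + suc (q * 2)) ≡ (h + suc q) * 2
      lemma = solve-∀

    rows-full : ∀ i → i ≤ suc q → symSum (row a b) (i * 2) ≡ boxCount i
    rows-full zero _ = cong (_+ 0) row-zero
    rows-full (suc i) (s≤s i≤q) = begin
      symSum (row a b) (suc i * 2)
        ≡⟨ symSum-step (row a b) i ⟩
      symSum (row a b) (i * 2) + 2 * (row a b (suc (i * 2)) + row a b (suc i * 2))
        ≡⟨ cong₂ (λ s p → s + 2 * p) (rows-full i (m≤n⇒m≤1+n i≤q)) pair ⟩
      boxCount i + 2 * (3 * a + 1)
        ≡⟨ boxCount-suc i ⟩
      boxCount (suc i)
        ∎
      where
      open ≡-Reasoning
      t = proj₁ (m≤n⇒∃[o]m+o≡n i≤q)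
      c = (h + t) * 2
      u+c≡b : suc (i * 2) + c ≡ b
      u+c≡b = trans (lemma i t h) (cong (λ q → h * 2 + suc (q * 2)) (proj₂ (m≤n⇒∃[o]m+o≡n i≤q)))
        where
        lemma : ∀ i t h → suc (i * 2) + (h + t) * 2 ≡ h * 2 + suc ((i + t) * 2)
        lemma = solve-∀
      pair : row a b (suc (i * 2)) + row a b (suc i * 2) ≡ 3 * a + 1
      pair = trans (row-pair i 2∣a (divides (h + t) refl) u+c≡b)
                   (cong (λ m → 3 * m + 1) (m≤n⇒m⊓n≡m (*-monoˡ-≤ 2 (m≤m+n h t))))

    rows-cut : ∀ l → l ≤ j → symSum (row a b) ((l + suc q) * 2) + 6 * (l * suc l) ≡ boxCount (l + suc q)
    rows-cut zero _ = trans (+-identityʳ _) (rows-full (suc q) ≤-refl)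
    rows-cut (suc l) l<j = begin
      symSum (row a b) (suc i * 2) + 6 * (suc l * suc (suc l))
        ≡⟨ cong (_+ 6 * (suc l * suc (suc l))) (symSum-step (row a b) i) ⟩
      symSum (row a b) (i * 2) + 2 * (row a b (suc (i * 2)) + row a b (suc i * 2)) + 6 * (suc l * suc (suc l))
        ≡⟨ cong (λ p → symSum (row a b) (i * 2) + 2 * p + 6 * (suc l * suc (suc l))) pair ⟩
      symSum (row a b) (i * 2) + 2 * (3 * c + 1) + 6 * (suc l * suc (suc l))
        ≡⟨ lemma (symSum (row a b) (i * 2)) c l ⟩
      (symSum (row a b) (i * 2) + 6 * (l * suc l)) + 2 * (3 * (c + suc l * 2) + 1)
        ≡⟨ cong₂ (λ s m → s + 2 * (3 * m + 1)) (rows-cut l (<⇒≤ l<j)) (sym a≡c+[1+l]*2) ⟩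
      boxCount i + 2 * (3 * a + 1)
        ≡⟨ boxCount-suc i ⟩
      boxCount (suc i)
        ∎
      where
      open ≡-Reasoning
      i = l + suc q
      t = proj₁ (m≤n⇒∃[o]m+o≡n l<j)
      c = (suc q + t) * 2
      a≡c+[1+l]*2 : a ≡ c + suc l * 2
      a≡c+[1+l]*2 = trans (cong (λ j → suc (q + j) * 2) (sym (proj₂ (m≤n⇒∃[o]m+o≡n l<j)))) (lemma′ q l t)
        where
        lemma′ : ∀ q l t → suc (q + (suc l + t)) * 2 ≡ (suc q + t) * 2 + suc l * 2
        lemma′ = solve-∀
      u+c≡b : suc (i * 2) + c ≡ b
      u+c≡b = trans (lemma″ l q c) (cong (_+ suc (q * 2)) (sym a≡c+[1+l]*2))
        where
        lemma″ : ∀ l q c → suc ((l + suc q) * 2) + c ≡ c + suc l * 2 + suc (q * 2)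
        lemma″ = solve-∀
      pair : row a b (suc (i * 2)) + row a b (suc i * 2) ≡ 3 * c + 1
      pair = trans (row-pair i 2∣a (divides (suc q + t) refl) u+c≡b)
                   (cong (λ m → 3 * m + 1) (m≥n⇒m⊓n≡n (subst (c ≤_) (sym a≡c+[1+l]*2) (m≤m+n c _))))
      lemma : ∀ s c l → s + 2 * (3 * c + 1) + 6 * (suc l * suc (suc l))
                      ≡ (s + 6 * (l * suc l)) + 2 * (3 * (c + suc l * 2) + 1)
      lemma = solve-∀

    count-lattice : length (lattice a b) + 6 * (j * suc j) ≡ 3 * (a * a) + 2 * a
    count-lattice = begin
      length (lattice a b) + 6 * (j * suc j)
        ≡⟨ cong (_+ 6 * (j * suc j)) (length-filter-cartesianProduct P? (range a) (range a)) ⟩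
      symSum (row a b) a + 6 * (j * suc j)
        ≡⟨ cong (λ i → symSum (row a b) (i * 2) + 6 * (j * suc j)) h≡j+1+q ⟩
      symSum (row a b) ((j + suc q) * 2) + 6 * (j * suc j)
        ≡⟨ rows-cut j ≤-refl ⟩
      boxCount (j + suc q)
        ≡⟨ cong boxCount h≡j+1+q ⟨
      a + a * (3 * a + 1)
        ≡⟨ lemma a ⟩
      3 * (a * a) + 2 * a
        ∎
      where
      open ≡-Reasoning
      P? = λ ((x , y) : ℤ × ℤ) → admissible? b ∣ x ∣ ∣ y ∣
      h≡j+1+q : h ≡ j + suc q
      h≡j+1+q = trans (cong suc (+-comm q j)) (sym (+-suc j q))
      lemma : ∀ a → a + a * (3 * a + 1) ≡ 3 * (a * a) + 2 * a
      lemma = solve-∀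

    card-InS : ∀ n → w n ≡ a + 2 → w (suc n) ≡ b + 3 → w n ≡ suc j + w (n ∸ 1) → HasCard (InS n) (sizeS n)
    card-InS n wₙ wₙ₊₁ wₙ-wₙ₋₁ = lattice a b , lattice-unique a b , membership , size
      where
      open Equivalence
      A≡a : wℤ n ℤ.- + 2 ≡ + a
      A≡a = trans (cong (λ m → + m ℤ.- + 2) wₙ) (+[m+n]-+n≡+m a 2)
      B≡b : wℤ (suc n) ℤ.- + 3 ≡ + b
      B≡b = trans (cong (λ m → + m ℤ.- + 3) wₙ₊₁) (+[m+n]-+n≡+m b 3)
      D≡1+j : wℤ n ℤ.- wℤ (n ∸ 1) ≡ + suc j
      D≡1+j = trans (cong (λ m → + m ℤ.- wℤ (n ∸ 1)) wₙ-wₙ₋₁) (+[m+n]-+n≡+m (suc j) (w (n ∸ 1)))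
      membership : ∀ p → (p ∈ lattice a b → InS n p) × (InS n p → p ∈ lattice a b)
      membership (x , y) =
        from (InS⇔ {n} A≡a B≡b) ∘ to ∈-lattice , from ∈-lattice ∘ to (InS⇔ {n} A≡a B≡b)
      size : + length (lattice a b) ≡ sizeS n
      size = trans (sizeFormula-+ {a = a} {d = j} count-lattice) (sym (cong₂ sizeFormula A≡a D≡1+j))

  w-even : ∀ k → w (k * 2) ≡ 3 * 2 ^ k
  w-even k = cong₂ (λ r e → (3 + r) * 2 ^ e) (m*n%n≡0 k 2) (m*n/n≡m k 2)

  w-odd : ∀ k → w (suc (k * 2)) ≡ 4 * 2 ^ k
  w-odd k = cong₂ (λ r e → (3 + r) * 2 ^ e)
    ([m+kn]%n≡m%n 1 k 2) (trans (+-distrib-/ 1 (k * 2) 1%2+[k*2]%2<2) (m*n/n≡m k 2))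
    where
    1%2+[k*2]%2<2 : 1 % 2 + (k * 2) % 2 < 2
    1%2+[k*2]%2<2 = subst (λ r → 1 + r < 2) (sym (m*n%n≡0 k 2)) ≤-refl

  2^k≡suc-pred : ∀ k → 2 ^ k ≡ suc (pred (2 ^ k))
  2^k≡suc-pred k = sym (suc-pred (2 ^ k) {{m^n≢0 2 k}})

  card-odd : ∀ k → HasCard (InS (suc (k * 2))) (sizeS (suc (k * 2)))
  card-odd k = Octagon.card-InS r r (suc (k * 2))
    (trans w₁ (lemma₁ r))
    (trans w₂ (lemma₂ r))
    (trans w₁ (trans (lemma₃ r) (cong (λ m → suc r + m) (sym w₀))))
    where
    r = pred (2 ^ k)
    w₀ : w (k * 2) ≡ 3 * suc r
    w₀ = trans (w-even k) (cong (3 *_) (2^k≡suc-pred k))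
    w₁ : w (suc (k * 2)) ≡ 4 * suc r
    w₁ = trans (w-odd k) (cong (4 *_) (2^k≡suc-pred k))
    w₂ : w (suc k * 2) ≡ 3 * (2 * suc r)
    w₂ = trans (w-even (suc k)) (cong (λ p → 3 * (2 * p)) (2^k≡suc-pred k))
    lemma₁ : ∀ r → 4 * suc r ≡ suc (r + r) * 2 + 2
    lemma₁ = solve-∀
    lemma₂ : ∀ r → 3 * (2 * suc r) ≡ suc (r + r) * 2 + suc (r * 2) + 3
    lemma₂ = solve-∀
    lemma₃ : ∀ r → 4 * suc r ≡ suc r + 3 * suc r
    lemma₃ = solve-∀

  card-even : ∀ k → HasCard (InS (suc k * 2)) (sizeS (suc k * 2))
  card-even k = Octagon.card-InS r (suc (r * 2)) (suc k * 2)
    (trans w₂ (lemma₁ r))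
    (trans w₃ (lemma₂ r))
    (trans w₂ (trans (lemma₃ r) (cong (λ m → suc (suc (r * 2)) + m) (sym w₁))))
    where
    r = pred (2 ^ k)
    w₁ : w (suc (k * 2)) ≡ 4 * suc r
    w₁ = trans (w-odd k) (cong (4 *_) (2^k≡suc-pred k))
    w₂ : w (suc k * 2) ≡ 3 * (2 * suc r)
    w₂ = trans (w-even (suc k)) (cong (λ p → 3 * (2 * p)) (2^k≡suc-pred k))
    w₃ : w (suc (suc k * 2)) ≡ 4 * (2 * suc r)
    w₃ = trans (w-odd (suc k)) (cong (λ p → 4 * (2 * p)) (2^k≡suc-pred k))
    lemma₁ : ∀ r → 3 * (2 * suc r) ≡ suc (r + suc (r * 2)) * 2 + 2
    lemma₁ = solve-∀
    lemma₂ : ∀ r → 4 * (2 * suc r) ≡ suc (r + suc (r * 2)) * 2 + suc (r * 2) + 3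
    lemma₂ = solve-∀
    lemma₃ : ∀ r → 3 * (2 * suc r) ≡ suc (suc (r * 2)) + 4 * suc r
    lemma₃ = solve-∀

  even-or-odd : ∀ m → (∃ λ k → m ≡ k * 2) ⊎ (∃ λ k → m ≡ suc (k * 2))
  even-or-odd zero = inj₁ (0 , refl)
  even-or-odd (suc m) with even-or-odd m
  ... | inj₁ (k , m≡2k) = inj₂ (k , cong suc m≡2k)
  ... | inj₂ (k , m≡1+2k) = inj₁ (suc k , cong suc m≡1+2k)

open import Data.Nat using (ℕ; suc; _≥_; _∸_)
open import Data.Integer using (ℤ; +_; _+_; _-_; _*_)
open import Data.Product using (_,_)
open import Data.Sum using (inj₁; inj₂)
open import Relation.Binary.PropositionalEquality using (refl)
open OctagonCount using (even-or-odd; card-odd; card-even)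

lemma4p1 : (n : ℕ) → n ≥ 1 →
    HasCard (InS n)
      (+ 3 * (wℤ n - + 2) * (wℤ n - + 2) + + 2 * (wℤ n - + 2)
        - + 6 * (wℤ n - wℤ (n ∸ 1)) * (wℤ n - wℤ (n ∸ 1) - + 1))
lemma4p1 (suc m) _ with even-or-odd m
... | inj₁ (k , refl) = card-odd k
... | inj₂ (k , refl) = card-even k
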